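{- Let $n,t$ be positive integers and let $G$ be the graph with vertex set $\mathcal P(n)$ in which distinct $A,B$ are adjacent iff $d(A,B)\le 2t$. Let $\alpha=\frac{n}{10\,t\,H(n,t)}$. If $\mathcal C\subseteq\mathcal P(n)$ satisfies $|\mathcal C|\ge 2H(n,t)$, then there is $A\in\mathcal C$ whose degree in the induced subgraph $G[\mathcal C]$ is at least $\alpha|\mathcal C|$.
   Context: The Hamming distance is $d(A,B)=|A\setminus B|+|B\setminus A|$. Let $V(n,t)=\sum_{k=0}^t\binom nk$ and $H(n,t)=2^n/V(n,t)$. -}

module Defs where

open import Data.Nat using (ℕ; zero; suc; _+_; _*_; _≤_; _≤?_)
open import Data.Nat.Combinatorics using (_C_)
open import Data.Bool using (Bool)
import Data.Bool.Properties as BoolP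
open import Data.Fin.Subset using (Subset; ∣_∣; _─_)
open import Data.Vec.Properties using (≡-dec)
open import Data.List using (List; length; filter)
open import Data.Product using (_×_)
open import Relation.Binary.PropositionalEquality using (_≡_)
open import Relation.Nullary using (¬_; Dec)
open import Relation.Nullary.Decidable using (_×-dec_; ¬?)

dist : ∀ {n} → Subset n → Subset n → ℕ
dist A B = ∣ A ─ B ∣ + ∣ B ─ A ∣

V : ℕ → ℕ → ℕ
V n zero = n C 0
V n (suc t) = V n t + n C (suc t)

_≟S_ : ∀ {n} (A B : Subset n) → Dec (A ≡ B)
_≟S_ = ≡-dec BoolP._≟_

Adj : ∀ {n} → ℕ → Subset n → Subset n → Set
Adj t A B = (¬ A ≡ B) × (dist A B ≤ 2 * t)

adj? : ∀ {n} (t : ℕ) (A B : Subset n) → Dec (Adj t A B)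
adj? t A B = ¬? (A ≟S B) ×-dec (dist A B ≤? 2 * t)

-- degree of A in the induced subgraph G[C] (C a duplicate-free list)
degIn : ∀ {n} → ℕ → List (Subset n) → Subset n → ℕ
degIn t C A = length (filter (adj? t A) C)

module Submission where

-- Let c(x) be the number of codewords whose Hamming ball of radius t contains x. Then
-- Σₓ c(x) = |C|·V(n,t) and Σₓ c(x)² = Σ_{A,B ∈ C} |B_t(A) ∩ B_t(B)|. Balls of non-adjacent
-- codewords are disjoint. If A ≠ B are adjacent, fix a coordinate i where they differ: a point
-- of B_t(A) ∩ B_t(B) differs in coordinate i from A or from B, and each ball has
-- V(n−1,t−1) ≤ t·V(n,t)/n such points. Hence n·Σ c² ≤ (n + 2tD)·|C|V, where D is the degree of
-- a codeword of at least average degree. Conversely c² ≥ (2k+1)c − k(k+1) for integers, and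
-- k + 1 = ⌊|C|V/2ⁿ⌋ ≥ 2 gives Σ c² ≥ (k+1)·|C|V. Comparing the two bounds gives nk ≤ 2tD,
-- so n|C|V ≤ n(k+2)·2ⁿ ≤ 3nk·2ⁿ ≤ 6tD·2ⁿ.

open import Defs
open import Data.Nat using (ℕ; _+_; _*_; _^_; _≤_; _≥_; _>_)
open import Data.Fin.Subset using (Subset)
open import Data.List using (List; length)
open import Data.List.Membership.Propositional using (_∈_)
open import Data.List.Relation.Unary.Unique.Propositional using (Unique)
open import Data.Product using (Σ-syntax; _×_)

open import Algebra.Properties.CommutativeSemigroup using (interchange)
open import Data.Bool using (true; false; _xor_; if_then_else_)
open import Data.Empty using (⊥-elim)
open import Data.Fin using (Fin; zero; suc)
open import Data.List using ([]; _∷_; filter)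
open import Data.List.Relation.Unary.All using (All; []; _∷_)
open import Data.List.Relation.Unary.AllPairs using ([]; _∷_)
open import Data.List.Relation.Unary.Any using (here; there)
open import Data.Nat using (zero; suc; _<_; _≰_; _≤?_; NonZero; >-nonZero; >-nonZero⁻¹; z≤n; s≤s)
open import Data.Nat.DivMod using (_/_; _%_; m≡m%n+[m/n]*n; m%n<n; m/n*n≤m; /-monoˡ-≤; m*n/n≡m)
open import Data.Nat.Properties
open import Data.Nat.Solver using (module +-*-Solver)
open import Data.Product using (_,_; proj₁; proj₂)
open import Data.Sum using (inj₁; inj₂)
open import Data.Vec using ([]; _∷_; lookup; removeAt)
open import Function using (_∘_)
open import Relation.Binary.PropositionalEquality
open import Relation.Nullary using (Dec; yes; no)

open +-*-Solver using (solve; _:+_; _:*_; _:=_; con)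

+-interchange : ∀ a b c d → (a + b) + (c + d) ≡ (a + c) + (b + d)
+-interchange = interchange +-commutativeSemigroup

module BallVolume where

  open import Data.Nat.Combinatorics using (_C_; nCk+nC[k+1]≡[n+1]C[k+1]; nC1≡n; k>n⇒nCk≡0)

  V-zeroˡ : ∀ r → V 0 r ≡ 1
  V-zeroˡ zero = refl
  V-zeroˡ (suc r) = cong₂ _+_ (V-zeroˡ r) (k>n⇒nCk≡0 {0} {suc r} (s≤s z≤n))

  V⁻ : ℕ → ℕ → ℕ
  V⁻ n zero = 0
  V⁻ n (suc r) = V n r

  V⁻+C≡V : ∀ n r → V⁻ n r + n C r ≡ V n r
  V⁻+C≡V n zero = refl
  V⁻+C≡V n (suc r) = refl

  V-pascal : ∀ n r → V (suc n) r ≡ V n r + V⁻ n r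
  V-pascal n zero = refl
  V-pascal n (suc r) = begin
    V (suc n) r + suc n C suc r
      ≡⟨ cong₂ _+_ (V-pascal n r) (sym (nCk+nC[k+1]≡[n+1]C[k+1] n r)) ⟩
    (V n r + V⁻ n r) + (n C r + n C suc r)
      ≡⟨ solve 4 (λ a b c d → (a :+ b) :+ (c :+ d) := (a :+ d) :+ (b :+ c)) refl (V n r) (V⁻ n r) (n C r) (n C suc r) ⟩
    (V n r + n C suc r) + (V⁻ n r + n C r)
      ≡⟨ cong (V n (suc r) +_) (V⁻+C≡V n r) ⟩
    V n (suc r) + V n r
      ∎
    where open ≡-Reasoning

  C-absorption : ∀ n k → suc k * (suc n C suc k) ≡ suc n * (n C k)
  C-absorption n zero = trans (+-identityʳ _) (trans (nC1≡n (suc n)) (sym (*-identityʳ (suc n))))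
  C-absorption zero (suc k) = trans (cong (suc (suc k) *_) (k>n⇒nCk≡0 {1} {suc (suc k)} (s≤s (s≤s z≤n)))) (*-zeroʳ (suc (suc k)))
  C-absorption (suc n) (suc k) = begin
    suc (suc k) * (suc (suc n) C suc (suc k))
      ≡⟨ cong (suc (suc k) *_) (sym (nCk+nC[k+1]≡[n+1]C[k+1] (suc n) (suc k))) ⟩
    suc (suc k) * (a + b)
      ≡⟨ solve 3 (λ k a b → (con 2 :+ k) :* (a :+ b) := a :+ (con 1 :+ k) :* a :+ (con 2 :+ k) :* b) refl k a b ⟩
    a + suc k * a + suc (suc k) * b
      ≡⟨ cong₂ (λ u v → a + u + v) (C-absorption n k) (C-absorption n (suc k)) ⟩
    a + suc n * (n C k) + suc n * (n C suc k)
      ≡⟨ solve 4 (λ a n c d → a :+ (con 1 :+ n) :* c :+ (con 1 :+ n) :* d := a :+ (con 1 :+ n) :* (c :+ d)) refl a n (n C k) (n C suc k) ⟩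
    a + suc n * (n C k + n C suc k)
      ≡⟨ cong (λ c → a + suc n * c) (nCk+nC[k+1]≡[n+1]C[k+1] n k) ⟩
    suc (suc n) * a
      ∎
    where
    open ≡-Reasoning
    a = suc n C suc k
    b = suc n C suc (suc k)

  -- Termwise, (n + 1)·C(n,k) = (k + 1)·C(n+1,k+1) ≤ (r + 1)·C(n+1,k+1) for k ≤ r.
  [1+n]*V≤[1+r]*V[1+n] : ∀ n r → suc n * V n r ≤ suc r * V (suc n) (suc r)
  [1+n]*V≤[1+r]*V[1+n] n zero = begin
    suc n * 1                 ≡⟨ *-identityʳ (suc n) ⟩
    suc n                     ≤⟨ n≤1+n (suc n) ⟩
    suc (suc n)               ≡⟨ cong suc (sym (nC1≡n (suc n))) ⟩
    1 + suc n C 1             ≡⟨ sym (+-identityʳ _) ⟩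
    1 * V (suc n) 1           ∎
    where open ≤-Reasoning
  [1+n]*V≤[1+r]*V[1+n] n (suc r) = begin
    suc n * (V n r + n C suc r)
      ≡⟨ *-distribˡ-+ (suc n) (V n r) (n C suc r) ⟩
    suc n * V n r + suc n * (n C suc r)
      ≤⟨ +-mono-≤ ([1+n]*V≤[1+r]*V[1+n] n r) (≤-reflexive (sym (C-absorption n (suc r)))) ⟩
    suc r * V (suc n) (suc r) + suc (suc r) * (suc n C suc (suc r))
      ≤⟨ +-monoˡ-≤ _ (*-monoˡ-≤ (V (suc n) (suc r)) (n≤1+n (suc r))) ⟩
    suc (suc r) * V (suc n) (suc r) + suc (suc r) * (suc n C suc (suc r))
      ≡⟨ sym (*-distribˡ-+ (suc (suc r)) (V (suc n) (suc r)) (suc n C suc (suc r))) ⟩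
    suc (suc r) * V (suc n) (suc (suc r))
      ∎
    where open ≤-Reasoning

  [1+n]*V⁻≤r*V[1+n] : ∀ n r → suc n * V⁻ n r ≤ r * V (suc n) r
  [1+n]*V⁻≤r*V[1+n] n zero = ≤-reflexive (*-zeroʳ (suc n))
  [1+n]*V⁻≤r*V[1+n] n (suc r) = [1+n]*V≤[1+r]*V[1+n] n r

open BallVolume

cubeSum : ∀ {n} → (Subset n → ℕ) → ℕ
cubeSum {zero} f = f []
cubeSum {suc n} f = cubeSum (f ∘ (true ∷_)) + cubeSum (f ∘ (false ∷_))

cubeSum-cong : ∀ {n} {f g : Subset n → ℕ} → (∀ x → f x ≡ g x) → cubeSum f ≡ cubeSum g
cubeSum-cong {zero} f≗g = f≗g []
cubeSum-cong {suc n} f≗g = cong₂ _+_ (cubeSum-cong (f≗g ∘ (true ∷_))) (cubeSum-cong (f≗g ∘ (false ∷_)))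

cubeSum-mono : ∀ {n} {f g : Subset n → ℕ} → (∀ x → f x ≤ g x) → cubeSum f ≤ cubeSum g
cubeSum-mono {zero} f≤g = f≤g []
cubeSum-mono {suc n} f≤g = +-mono-≤ (cubeSum-mono (f≤g ∘ (true ∷_))) (cubeSum-mono (f≤g ∘ (false ∷_)))

cubeSum-+ : ∀ {n} (f g : Subset n → ℕ) → cubeSum (λ x → f x + g x) ≡ cubeSum f + cubeSum g
cubeSum-+ {zero} f g = refl
cubeSum-+ {suc n} f g = trans
  (cong₂ _+_ (cubeSum-+ (f ∘ (true ∷_)) (g ∘ (true ∷_))) (cubeSum-+ (f ∘ (false ∷_)) (g ∘ (false ∷_))))
  (+-interchange (cubeSum (f ∘ (true ∷_))) _ _ _)

cubeSum-*ˡ : ∀ {n} a (f : Subset n → ℕ) → cubeSum (λ x → a * f x) ≡ a * cubeSum f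
cubeSum-*ˡ {zero} a f = refl
cubeSum-*ˡ {suc n} a f =
  trans (cong₂ _+_ (cubeSum-*ˡ a (f ∘ (true ∷_))) (cubeSum-*ˡ a (f ∘ (false ∷_)))) (sym (*-distribˡ-+ a _ _))

cubeSum-const : ∀ {n} a → cubeSum {n} (λ _ → a) ≡ 2 ^ n * a
cubeSum-const {zero} a = sym (+-identityʳ a)
cubeSum-const {suc n} a = begin
  cubeSum {n} (λ _ → a) + cubeSum {n} (λ _ → a)   ≡⟨ cong₂ _+_ (cubeSum-const {n} a) (cubeSum-const {n} a) ⟩
  2 ^ n * a + 2 ^ n * a                              ≡⟨ cong (2 ^ n * a +_) (sym (+-identityʳ (2 ^ n * a))) ⟩
  2 * (2 ^ n * a)                                    ≡⟨ sym (*-assoc 2 (2 ^ n) a) ⟩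
  2 ^ suc n * a                                      ∎
  where open ≡-Reasoning

cubeSum-zero : ∀ {n} → cubeSum {n} (λ _ → 0) ≡ 0
cubeSum-zero {n} = trans (cubeSum-const {n} 0) (*-zeroʳ (2 ^ n))

hamming : ∀ {n} → Subset n → Subset n → ℕ
hamming [] [] = 0
hamming (a ∷ A) (b ∷ B) = (if a xor b then 1 else 0) + hamming A B

dist≡hamming : ∀ {n} (A B : Subset n) → dist A B ≡ hamming A B
dist≡hamming [] [] = refl
dist≡hamming (true ∷ A) (true ∷ B) = dist≡hamming A B
dist≡hamming (true ∷ A) (false ∷ B) = cong suc (dist≡hamming A B)
dist≡hamming (false ∷ A) (true ∷ B) = trans (+-suc _ _) (cong suc (dist≡hamming A B))
dist≡hamming (false ∷ A) (false ∷ B) = dist≡hamming A B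

hamming-triangle : ∀ {n} (A B X : Subset n) → hamming A B ≤ hamming A X + hamming B X
hamming-triangle [] [] [] = z≤n
hamming-triangle (a ∷ A) (b ∷ B) (x ∷ X) = ≤-trans
  (+-mono-≤ (bit-triangle a b x) (hamming-triangle A B X))
  (≤-reflexive (+-interchange (if a xor x then 1 else 0) _ _ _))
  where
  bit-triangle : ∀ a b x → (if a xor b then 1 else 0) ≤ (if a xor x then 1 else 0) + (if b xor x then 1 else 0)
  bit-triangle true true x = z≤n
  bit-triangle false false x = z≤n
  bit-triangle true false true = s≤s z≤n
  bit-triangle true false false = s≤s z≤n
  bit-triangle false true true = s≤s z≤n
  bit-triangle false true false = s≤s z≤n

≢⇒differ : ∀ {n} {A B : Subset n} → A ≢ B → Σ[ i ∈ Fin n ] lookup A i xor lookup B i ≡ true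
≢⇒differ {A = []} {[]} A≢B = ⊥-elim (A≢B refl)
≢⇒differ {A = true ∷ A} {false ∷ B} _ = zero , refl
≢⇒differ {A = false ∷ A} {true ∷ B} _ = zero , refl
≢⇒differ {A = true ∷ A} {true ∷ B} A≢B = let i , p = ≢⇒differ (A≢B ∘ cong (true ∷_)) in suc i , p
≢⇒differ {A = false ∷ A} {false ∷ B} A≢B = let i , p = ≢⇒differ (A≢B ∘ cong (false ∷_)) in suc i , p

-- The indicator of d ≤ r, by recursion so that atMost (suc d) (suc r) reduces to atMost d r.
atMost : ℕ → ℕ → ℕ
atMost zero r = 1
atMost (suc d) zero = 0
atMost (suc d) (suc r) = atMost d r

atMost≤1 : ∀ d r → atMost d r ≤ 1
atMost≤1 zero r = ≤-refl
atMost≤1 (suc d) zero = z≤n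
atMost≤1 (suc d) (suc r) = atMost≤1 d r

atMost-≰ : ∀ {d r} → d ≰ r → atMost d r ≡ 0
atMost-≰ {zero} d≰r = ⊥-elim (d≰r z≤n)
atMost-≰ {suc d} {zero} _ = refl
atMost-≰ {suc d} {suc r} d≰r = atMost-≰ (d≰r ∘ s≤s)

inBall : ∀ {n} → ℕ → Subset n → Subset n → ℕ
inBall r A x = atMost (hamming A x) r

cubeSum-inBall : ∀ {n} (A : Subset n) r → cubeSum (inBall r A) ≡ V n r
cubeSum-inShell : ∀ {n} (A : Subset n) r → cubeSum (λ x → atMost (suc (hamming A x)) r) ≡ V⁻ n r

cubeSum-inBall [] r = sym (V-zeroˡ r)
cubeSum-inBall {suc n} (true ∷ A) r =
  trans (cong₂ _+_ (cubeSum-inBall A r) (cubeSum-inShell A r)) (sym (V-pascal n r))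
cubeSum-inBall {suc n} (false ∷ A) r =
  trans (cong₂ _+_ (cubeSum-inShell A r) (cubeSum-inBall A r)) (trans (+-comm (V⁻ n r) (V n r)) (sym (V-pascal n r)))

cubeSum-inShell {n} A zero = cubeSum-zero {n}
cubeSum-inShell A (suc r) = cubeSum-inBall A r

cubeSum-off : ∀ {m} (g : ℕ → ℕ) (A : Subset (suc m)) i →
  cubeSum (λ x → if lookup x i xor lookup A i then g (hamming A x) else 0)
    ≡ cubeSum (λ y → g (suc (hamming (removeAt A i) y)))
cubeSum-off {m} g (true ∷ A) zero = cong₂ _+_ (cubeSum-zero {m}) refl
cubeSum-off {m} g (false ∷ A) zero = trans (cong₂ _+_ refl (cubeSum-zero {m})) (+-identityʳ _)
cubeSum-off g (true ∷ A@(_ ∷ _)) (suc j) = cong₂ _+_ (cubeSum-off g A j) (cubeSum-off (g ∘ suc) A j)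
cubeSum-off g (false ∷ A@(_ ∷ _)) (suc j) = cong₂ _+_ (cubeSum-off (g ∘ suc) A j) (cubeSum-off g A j)

m≤1⇒m*n≤n : ∀ {m n} → m ≤ 1 → m * n ≤ n
m≤1⇒m*n≤n {n = n} m≤1 = ≤-trans (*-monoˡ-≤ n m≤1) (≤-reflexive (+-identityʳ n))

n≤1⇒m*n≤m : ∀ {m n} → n ≤ 1 → m * n ≤ m
n≤1⇒m*n≤m {m} n≤1 = ≤-trans (*-monoʳ-≤ m n≤1) (≤-reflexive (*-identityʳ m))

*-≤-either : ∀ x a b → a xor b ≡ true → ∀ {u v} → u ≤ 1 → v ≤ 1 →
  u * v ≤ (if x xor a then u else 0) + (if x xor b then v else 0)
*-≤-either true true false _ u≤1 _ = m≤1⇒m*n≤n u≤1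
*-≤-either false false true _ u≤1 _ = m≤1⇒m*n≤n u≤1
*-≤-either true false true _ _ v≤1 = ≤-trans (n≤1⇒m*n≤m v≤1) (m≤m+n _ 0)
*-≤-either false true false _ _ v≤1 = ≤-trans (n≤1⇒m*n≤m v≤1) (m≤m+n _ 0)
*-≤-either _ true true ()
*-≤-either _ false false ()

ballOverlap : ∀ {n} → ℕ → Subset n → Subset n → ℕ
ballOverlap r A B = cubeSum (λ x → inBall r A x * inBall r B x)

ballOverlap≤V : ∀ {n} r (A B : Subset n) → ballOverlap r A B ≤ V n r
ballOverlap≤V r A B = ≤-trans
  (cubeSum-mono (λ x → n≤1⇒m*n≤m (atMost≤1 (hamming B x) r)))
  (≤-reflexive (cubeSum-inBall A r))

ballOverlap-far : ∀ {n} r (A B : Subset n) → hamming A B ≰ 2 * r → ballOverlap r A B ≡ 0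
ballOverlap-far {n} r A B far = trans (cubeSum-cong disjoint) (cubeSum-zero {n})
  where
  disjoint : ∀ x → inBall r A x * inBall r B x ≡ 0
  disjoint x with hamming A x ≤? r | hamming B x ≤? r
  ... | no A≰ | _ = cong (_* inBall r B x) (atMost-≰ A≰)
  ... | yes _ | no B≰ = trans (cong (inBall r A x *_) (atMost-≰ B≰)) (*-zeroʳ (inBall r A x))
  ... | yes A≤ | yes B≤ = ⊥-elim (far (begin
    hamming A B               ≤⟨ hamming-triangle A B x ⟩
    hamming A x + hamming B x ≤⟨ +-mono-≤ A≤ (≤-trans B≤ (m≤m+n r 0)) ⟩
    2 * r                     ∎))
    where open ≤-Reasoning

ballOverlap-distinct : ∀ {n} r (A B : Subset n) → A ≢ B → n * ballOverlap r A B ≤ 2 * r * V n r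
ballOverlap-distinct {zero} r [] [] []≢[] = ⊥-elim ([]≢[] refl)
ballOverlap-distinct {suc m} r A B A≢B = begin
  suc m * ballOverlap r A B                    ≤⟨ *-monoʳ-≤ (suc m) (cubeSum-mono product≤either) ⟩
  suc m * cubeSum (λ x → off A x + off B x)    ≡⟨ cong (suc m *_) (cubeSum-+ (off A) (off B)) ⟩
  suc m * (cubeSum (off A) + cubeSum (off B))  ≡⟨ cong (suc m *_) (cong₂ _+_ (offCount A) (offCount B)) ⟩
  suc m * (V⁻ m r + V⁻ m r)                    ≡⟨ solve 2 (λ k v → k :* (v :+ v) := con 2 :* (k :* v)) refl (suc m) (V⁻ m r) ⟩
  2 * (suc m * V⁻ m r)                         ≤⟨ *-monoʳ-≤ 2 ([1+n]*V⁻≤r*V[1+n] m r) ⟩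
  2 * (r * V (suc m) r)                        ≡⟨ sym (*-assoc 2 r (V (suc m) r)) ⟩
  2 * r * V (suc m) r                          ∎
  where
  open ≤-Reasoning
  differ = ≢⇒differ A≢B
  i = proj₁ differ
  off : Subset (suc m) → Subset (suc m) → ℕ
  off Y x = if lookup x i xor lookup Y i then inBall r Y x else 0
  offCount : ∀ Y → cubeSum (off Y) ≡ V⁻ m r
  offCount Y = trans (cubeSum-off (λ d → atMost d r) Y i) (cubeSum-inShell (removeAt Y i) r)
  product≤either : ∀ x → inBall r A x * inBall r B x ≤ off A x + off B x
  product≤either x = *-≤-either (lookup x i) (lookup A i) (lookup B i) (proj₂ differ)
    (atMost≤1 (hamming A x) r) (atMost≤1 (hamming B x) r)

sumOver : ∀ {X : Set} → List X → (X → ℕ) → ℕ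
sumOver [] f = 0
sumOver (a ∷ L) f = f a + sumOver L f

module _ {X : Set} where

  sumOver-cong : (L : List X) {f g : X → ℕ} → (∀ a → f a ≡ g a) → sumOver L f ≡ sumOver L g
  sumOver-cong [] f≗g = refl
  sumOver-cong (a ∷ L) f≗g = cong₂ _+_ (f≗g a) (sumOver-cong L f≗g)

  sumOver-mono : (L : List X) {f g : X → ℕ} → (∀ a → f a ≤ g a) → sumOver L f ≤ sumOver L g
  sumOver-mono [] f≤g = z≤n
  sumOver-mono (a ∷ L) f≤g = +-mono-≤ (f≤g a) (sumOver-mono L f≤g)

  sumOver-+ : (L : List X) (f g : X → ℕ) → sumOver L (λ a → f a + g a) ≡ sumOver L f + sumOver L g
  sumOver-+ [] f g = refl
  sumOver-+ (a ∷ L) f g = trans (cong (f a + g a +_) (sumOver-+ L f g)) (+-interchange (f a) (g a) _ _)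

  sumOver-*ˡ : (L : List X) (k : ℕ) (f : X → ℕ) → sumOver L (λ a → k * f a) ≡ k * sumOver L f
  sumOver-*ˡ [] k f = sym (*-zeroʳ k)
  sumOver-*ˡ (a ∷ L) k f = trans (cong (k * f a +_) (sumOver-*ˡ L k f)) (sym (*-distribˡ-+ k (f a) (sumOver L f)))

  sumOver-*ʳ : (L : List X) (k : ℕ) (f : X → ℕ) → sumOver L (λ a → f a * k) ≡ sumOver L f * k
  sumOver-*ʳ [] k f = refl
  sumOver-*ʳ (a ∷ L) k f = trans (cong (f a * k +_) (sumOver-*ʳ L k f)) (sym (*-distribʳ-+ k (f a) (sumOver L f)))

  sumOver-const : (L : List X) (c : ℕ) → sumOver L (λ _ → c) ≡ length L * c
  sumOver-const [] c = refl
  sumOver-const (a ∷ L) c = cong (c +_) (sumOver-const L c)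

  cubeSum-sumOver : ∀ {n} (L : List X) (g : X → Subset n → ℕ) →
    cubeSum (λ x → sumOver L (λ a → g a x)) ≡ sumOver L (λ a → cubeSum (g a))
  cubeSum-sumOver {n} [] g = cubeSum-zero {n}
  cubeSum-sumOver (a ∷ L) g =
    trans (cubeSum-+ (g a) (λ x → sumOver L (λ b → g b x))) (cong (cubeSum (g a) +_) (cubeSum-sumOver L g))

  ∃-≥-average : (L : List X) (f : X → ℕ) → 0 < length L → Σ[ a ∈ X ] (a ∈ L × sumOver L f ≤ length L * f a)
  ∃-≥-average (a ∷ []) f _ = a , here refl , ≤-refl
  ∃-≥-average (a ∷ L@(_ ∷ _)) f _ with ∃-≥-average L f (s≤s z≤n)
  ... | b , b∈L , avg≤b with f a ≤? f b
  ...   | yes fa≤fb = b , there b∈L , +-mono-≤ fa≤fb avg≤b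
  ...   | no fa≰fb = a , here refl , +-monoʳ-≤ (f a) (≤-trans avg≤b (*-monoʳ-≤ (length L) (≰⇒≥ fa≰fb)))

𝟙 : ∀ {P : Set} → Dec P → ℕ
𝟙 (yes _) = 1
𝟙 (no _) = 0

length-filter≡sumOver-𝟙 : ∀ {X : Set} {P : X → Set} (P? : ∀ x → Dec (P x)) (L : List X) →
  length (filter P? L) ≡ sumOver L (𝟙 ∘ P?)
length-filter≡sumOver-𝟙 P? [] = refl
length-filter≡sumOver-𝟙 P? (x ∷ L) with P? x
... | yes _ = cong suc (length-filter≡sumOver-𝟙 P? L)
... | no _ = length-filter≡sumOver-𝟙 P? L

sumOver-𝟙≟-absent : ∀ {n} (A : Subset n) (L : List (Subset n)) → All (A ≢_) L → sumOver L (𝟙 ∘ (A ≟S_)) ≡ 0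
sumOver-𝟙≟-absent A [] [] = refl
sumOver-𝟙≟-absent A (B ∷ L) (A≢B ∷ A∉L) with A ≟S B
... | yes A≡B = ⊥-elim (A≢B A≡B)
... | no _ = sumOver-𝟙≟-absent A L A∉L

sumOver-𝟙≟-unique : ∀ {n} (A : Subset n) {L : List (Subset n)} → Unique L → sumOver L (𝟙 ∘ (A ≟S_)) ≤ 1
sumOver-𝟙≟-unique A [] = z≤n
sumOver-𝟙≟-unique A {B ∷ L} (B∉L ∷ L!) with A ≟S B
... | yes refl = ≤-reflexive (cong suc (sumOver-𝟙≟-absent A L B∉L))
... | no _ = sumOver-𝟙≟-unique A L!

cover : ∀ {n} → ℕ → List (Subset n) → Subset n → ℕ
cover t C x = sumOver C (λ A → inBall t A x)

cubeSum-cover : ∀ {n} t (C : List (Subset n)) → cubeSum (cover t C) ≡ length C * V n t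
cubeSum-cover {n} t C = begin
  cubeSum (cover t C)                   ≡⟨ cubeSum-sumOver C (inBall t) ⟩
  sumOver C (λ A → cubeSum (inBall t A)) ≡⟨ sumOver-cong C (λ A → cubeSum-inBall A t) ⟩
  sumOver C (λ _ → V n t)               ≡⟨ sumOver-const C (V n t) ⟩
  length C * V n t                      ∎
  where open ≡-Reasoning

cubeSum-cover² : ∀ {n} t (C : List (Subset n)) →
  cubeSum (λ x → cover t C x * cover t C x) ≡ sumOver C (λ A → sumOver C (ballOverlap t A))
cubeSum-cover² t C = begin
  cubeSum (λ x → cover t C x * cover t C x)
    ≡⟨ cubeSum-cong (λ x → sym (sumOver-*ʳ C (cover t C x) (λ A → inBall t A x))) ⟩
  cubeSum (λ x → sumOver C (λ A → inBall t A x * cover t C x))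
    ≡⟨ cubeSum-cong (λ x → sumOver-cong C (λ A → sym (sumOver-*ˡ C (inBall t A x) (λ B → inBall t B x)))) ⟩
  cubeSum (λ x → sumOver C (λ A → sumOver C (λ B → inBall t A x * inBall t B x)))
    ≡⟨ cubeSum-sumOver C (λ A x → sumOver C (λ B → inBall t A x * inBall t B x)) ⟩
  sumOver C (λ A → cubeSum (λ x → sumOver C (λ B → inBall t A x * inBall t B x)))
    ≡⟨ sumOver-cong C (λ A → cubeSum-sumOver C (λ B x → inBall t A x * inBall t B x)) ⟩
  sumOver C (λ A → sumOver C (ballOverlap t A))
    ∎
  where open ≡-Reasoning

n*ballOverlap≤ : ∀ {n} t (A B : Subset n) →
  n * ballOverlap t A B ≤ n * V n t * 𝟙 (A ≟S B) + 2 * t * V n t * 𝟙 (adj? t A B)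
n*ballOverlap≤ {n} t A B with A ≟S B | adj? t A B
... | yes refl | _ = begin
  n * ballOverlap t A A    ≤⟨ *-monoʳ-≤ n (ballOverlap≤V t A A) ⟩
  n * V n t                ≡⟨ sym (*-identityʳ (n * V n t)) ⟩
  n * V n t * 1            ≤⟨ m≤m+n _ _ ⟩
  n * V n t * 1 + _        ∎
  where open ≤-Reasoning
... | no A≢B | yes _ = begin
  n * ballOverlap t A B    ≤⟨ ballOverlap-distinct t A B A≢B ⟩
  2 * t * V n t            ≡⟨ sym (*-identityʳ (2 * t * V n t)) ⟩
  2 * t * V n t * 1        ≡⟨ cong (_+ 2 * t * V n t * 1) (sym (*-zeroʳ (n * V n t))) ⟩
  n * V n t * 0 + 2 * t * V n t * 1 ∎
  where open ≤-Reasoning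
... | no A≢B | no ¬adj = begin
  n * ballOverlap t A B    ≡⟨ cong (n *_) (ballOverlap-far t A B far) ⟩
  n * 0                    ≡⟨ *-zeroʳ n ⟩
  0                        ≤⟨ z≤n ⟩
  _                        ∎
  where
  open ≤-Reasoning
  far : hamming A B ≰ 2 * t
  far d≤2t = ¬adj (A≢B , subst (_≤ 2 * t) (sym (dist≡hamming A B)) d≤2t)

n*rowOverlap≤ : ∀ {n} t {C : List (Subset n)} → Unique C → ∀ A →
  n * sumOver C (ballOverlap t A) ≤ n * V n t + 2 * t * V n t * degIn t C A
n*rowOverlap≤ {n} t {C} C! A = begin
  n * sumOver C (ballOverlap t A)
    ≡⟨ sym (sumOver-*ˡ C n (ballOverlap t A)) ⟩
  sumOver C (λ B → n * ballOverlap t A B)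
    ≤⟨ sumOver-mono C (n*ballOverlap≤ t A) ⟩
  sumOver C (λ B → nV * 𝟙 (A ≟S B) + 2tV * 𝟙 (adj? t A B))
    ≡⟨ sumOver-+ C _ _ ⟩
  sumOver C (λ B → nV * 𝟙 (A ≟S B)) + sumOver C (λ B → 2tV * 𝟙 (adj? t A B))
    ≡⟨ cong₂ _+_ (sumOver-*ˡ C nV (𝟙 ∘ (A ≟S_))) (sumOver-*ˡ C 2tV (𝟙 ∘ adj? t A)) ⟩
  nV * sumOver C (𝟙 ∘ (A ≟S_)) + 2tV * sumOver C (𝟙 ∘ adj? t A)
    ≤⟨ +-monoˡ-≤ _ (*-monoʳ-≤ nV (sumOver-𝟙≟-unique A C!)) ⟩
  nV * 1 + 2tV * sumOver C (𝟙 ∘ adj? t A)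
    ≡⟨ cong₂ _+_ (*-identityʳ nV) (cong (2tV *_) (sym (length-filter≡sumOver-𝟙 (adj? t A) C))) ⟩
  nV + 2tV * degIn t C A
    ∎
  where
  open ≤-Reasoning
  nV = n * V n t
  2tV = 2 * t * V n t

cover²-upper : ∀ {n} t {C : List (Subset n)} → Unique C → ∀ D → sumOver C (degIn t C) ≤ length C * D →
  n * cubeSum (λ x → cover t C x * cover t C x) ≤ (n + 2 * t * D) * (length C * V n t)
cover²-upper {n} t {C} C! D avg≤D = begin
  n * cubeSum (λ x → cover t C x * cover t C x)
    ≡⟨ cong (n *_) (cubeSum-cover² t C) ⟩
  n * sumOver C (λ A → sumOver C (ballOverlap t A))
    ≡⟨ sym (sumOver-*ˡ C n _) ⟩
  sumOver C (λ A → n * sumOver C (ballOverlap t A))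
    ≤⟨ sumOver-mono C (n*rowOverlap≤ t C!) ⟩
  sumOver C (λ A → n * V n t + 2 * t * V n t * degIn t C A)
    ≡⟨ sumOver-+ C _ _ ⟩
  sumOver C (λ _ → n * V n t) + sumOver C (λ A → 2 * t * V n t * degIn t C A)
    ≡⟨ cong₂ _+_ (sumOver-const C (n * V n t)) (sumOver-*ˡ C (2 * t * V n t) (degIn t C)) ⟩
  m * (n * V n t) + 2 * t * V n t * sumOver C (degIn t C)
    ≤⟨ +-monoʳ-≤ (m * (n * V n t)) (*-monoʳ-≤ (2 * t * V n t) avg≤D) ⟩
  m * (n * V n t) + 2 * t * V n t * (m * D)
    ≡⟨ solve 5 (λ m n v t d → m :* (n :* v) :+ con 2 :* t :* v :* (m :* d) := (n :+ con 2 :* t :* d) :* (m :* v)) refl m n (V n t) t D ⟩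
  (n + 2 * t * D) * (m * V n t)
    ∎
  where
  open ≤-Reasoning
  m = length C

tangent-line : ∀ c k → (2 * k + 1) * c ≤ c * c + (k * k + k)
-- The two sides differ by (c − k)(c − k − 1), which is e(e + 1) in both cases.
tangent-line c k with ≤-<-connex c k
... | inj₁ c≤k with m≤n⇒∃[o]m+o≡n c≤k
...   | e , refl = ≤-trans (m≤m+n _ (e * e + e)) (≤-reflexive
          (solve 2 (λ c e → (con 2 :* (c :+ e) :+ con 1) :* c :+ (e :* e :+ e) := c :* c :+ ((c :+ e) :* (c :+ e) :+ (c :+ e))) refl c e))
tangent-line c k | inj₂ k<c with m≤n⇒∃[o]m+o≡n k<c
...   | e , refl = ≤-trans (m≤m+n _ (e * e + e)) (≤-reflexive
          (solve 2 (λ k e → (con 2 :* k :+ con 1) :* (con 1 :+ k :+ e) :+ (e :* e :+ e) := (con 1 :+ k :+ e) :* (con 1 :+ k :+ e) :+ (k :* k :+ k)) refl k e))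

cubeSum-tangent : ∀ {n} k (f : Subset n → ℕ) →
  (2 * k + 1) * cubeSum f ≤ cubeSum (λ x → f x * f x) + 2 ^ n * (k * k + k)
cubeSum-tangent {n} k f = begin
  (2 * k + 1) * cubeSum f                            ≡⟨ sym (cubeSum-*ˡ (2 * k + 1) f) ⟩
  cubeSum (λ x → (2 * k + 1) * f x)                  ≤⟨ cubeSum-mono (λ x → tangent-line (f x) k) ⟩
  cubeSum (λ x → f x * f x + (k * k + k))            ≡⟨ cubeSum-+ (λ x → f x * f x) (λ _ → k * k + k) ⟩
  cubeSum (λ x → f x * f x) + cubeSum {n} (λ _ → k * k + k) ≡⟨ cong (_ +_) (cubeSum-const {n} (k * k + k)) ⟩
  cubeSum (λ x → f x * f x) + 2 ^ n * (k * k + k)    ∎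
  where open ≤-Reasoning

[1+k]*Y≤X : ∀ {X Y P} k → suc k * P ≤ Y → (2 * k + 1) * Y ≤ X + P * (k * k + k) → suc k * Y ≤ X
[1+k]*Y≤X {X} {Y} {P} k [1+k]P≤Y tangent = +-cancelʳ-≤ (k * Y) (suc k * Y) X (begin
  suc k * Y + k * Y      ≡⟨ solve 2 (λ k y → (con 1 :+ k) :* y :+ k :* y := (con 2 :* k :+ con 1) :* y) refl k Y ⟩
  (2 * k + 1) * Y        ≤⟨ tangent ⟩
  X + P * (k * k + k)    ≡⟨ cong (X +_) (solve 2 (λ p k → p :* (k :* k :+ k) := k :* ((con 1 :+ k) :* p)) refl P k) ⟩
  X + k * (suc k * P)    ≤⟨ +-monoʳ-≤ X (*-monoʳ-≤ k [1+k]P≤Y) ⟩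
  X + k * Y              ∎)
  where open ≤-Reasoning

degree-bound-at : ∀ {n t D X Y P} k .{{_ : NonZero Y}} → 1 ≤ k → Y ≤ suc (suc k) * P →
  n * X ≤ (n + 2 * t * D) * Y → suc k * Y ≤ X → n * Y ≤ D * (10 * t * P)
degree-bound-at {n} {t} {D} {X} {Y} {P} k 1≤k Y≤[2+k]P upper [1+k]Y≤X = begin
  n * Y                  ≤⟨ *-monoʳ-≤ n Y≤[2+k]P ⟩
  n * (suc (suc k) * P)  ≤⟨ *-monoʳ-≤ n (*-monoˡ-≤ P 2+k≤3k) ⟩
  n * (3 * k * P)        ≡⟨ solve 3 (λ n k p → n :* (con 3 :* k :* p) := con 3 :* p :* (n :* k)) refl n k P ⟩
  3 * P * (n * k)        ≤⟨ *-monoʳ-≤ (3 * P) nk≤2tD ⟩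
  3 * P * (2 * t * D)    ≡⟨ solve 3 (λ p t d → con 3 :* p :* (con 2 :* t :* d) := d :* (con 6 :* t :* p)) refl P t D ⟩
  D * (6 * t * P)        ≤⟨ *-monoʳ-≤ D (*-monoˡ-≤ P (*-monoˡ-≤ t (m≤m+n 6 4))) ⟩
  D * (10 * t * P)       ∎
  where
  open ≤-Reasoning
  2+k≤3k : suc (suc k) ≤ 3 * k
  2+k≤3k = ≤-trans (+-monoˡ-≤ k (*-monoʳ-≤ 2 1≤k)) (≤-reflexive (solve 1 (λ k → con 2 :* k :+ k := con 3 :* k) refl k))
  nk≤2tD : n * k ≤ 2 * t * D
  nk≤2tD = +-cancelˡ-≤ n (n * k) (2 * t * D) (*-cancelʳ-≤ (n + n * k) (n + 2 * t * D) Y (begin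
    (n + n * k) * Y      ≡⟨ solve 3 (λ n k y → (n :+ n :* k) :* y := n :* ((con 1 :+ k) :* y)) refl n k Y ⟩
    n * (suc k * Y)      ≤⟨ *-monoʳ-≤ n [1+k]Y≤X ⟩
    n * X                ≤⟨ upper ⟩
    (n + 2 * t * D) * Y  ∎))

m<[1+m/n]*n : ∀ m n .{{_ : NonZero n}} → m < suc (m / n) * n
m<[1+m/n]*n m n = begin-strict
  m                    ≡⟨ m≡m%n+[m/n]*n m n ⟩
  m % n + m / n * n    <⟨ +-monoˡ-< (m / n * n) (m%n<n m n) ⟩
  n + m / n * n        ∎
  where open ≤-Reasoning

degree-bound : ∀ {n t D X Y P} .{{_ : NonZero P}} → 2 * P ≤ Y → n * X ≤ (n + 2 * t * D) * Y →
  (∀ k → (2 * k + 1) * Y ≤ X + P * (k * k + k)) → n * Y ≤ D * (10 * t * P)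
-- Apply the tangent bound at k = ⌊Y/P⌋ − 1.
degree-bound {n} {t} {D} {X} {Y} {P} 2P≤Y upper tangent
  with Y / P | m/n*n≤m Y P | m<[1+m/n]*n Y P | subst (_≤ Y / P) (m*n/n≡m 2 P) (/-monoˡ-≤ P 2P≤Y)
... | suc zero | _ | _ | s≤s ()
... | suc (suc k) | [2+k]P≤Y | Y<[3+k]P | _ =
  degree-bound-at {n} {t} {D} {X} {Y} {P} (suc k) {{>-nonZero 0<Y}} (s≤s z≤n) (<⇒≤ Y<[3+k]P) upper
    ([1+k]*Y≤X {X} {Y} {P} (suc k) [2+k]P≤Y (tangent (suc k)))
  where
  0<Y : 0 < Y
  0<Y = ≤-trans (>-nonZero⁻¹ P) (≤-trans (m≤m+n P _) 2P≤Y)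

lemma5p3 : (n t : ℕ) → n > 0 → t > 0 → (C : List (Subset n)) → Unique C
    → length C * V n t ≥ 2 * 2 ^ n
    → Σ[ A ∈ Subset n ] (A ∈ C × n * length C * V n t ≤ degIn t C A * (10 * t * 2 ^ n))
lemma5p3 n t _ _ [] _ 2·2ⁿ≤0 = ⊥-elim (<⇒≱ (m^n>0 2 (suc n)) 2·2ⁿ≤0)
lemma5p3 n t _ _ C@(_ ∷ _) C! 2·2ⁿ≤|C|V =
  let A , A∈C , Σdeg≤|C|degA = ∃-≥-average C (degIn t C) (s≤s z≤n)
  in A , A∈C , (begin
    n * length C * V n t         ≡⟨ *-assoc n (length C) (V n t) ⟩
    n * (length C * V n t)       ≤⟨ degree-bound {n} {t} {degIn t C A} {{m^n≢0 2 n}} 2·2ⁿ≤|C|V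
                                      (cover²-upper t C! (degIn t C A) Σdeg≤|C|degA) lower ⟩
    degIn t C A * (10 * t * 2 ^ n) ∎)
  where
  open ≤-Reasoning
  lower : ∀ k → (2 * k + 1) * (length C * V n t)
                  ≤ cubeSum (λ x → cover t C x * cover t C x) + 2 ^ n * (k * k + k)
  lower k = ≤-trans (≤-reflexive (cong ((2 * k + 1) *_) (sym (cubeSum-cover t C)))) (cubeSum-tangent k (cover t C))
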